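{- Let $\mathbb G$, $\mathbb H$ be graphs such that $\mathbb H$ has at least one vertex. Then there exists a surjective locally surjective homomorphism from $\mathbb G$ onto $\mathbb H$ if and only if there is a surjective $p$-morphism from $\operatorname{Pos}_\bot(\mathbb G)$ onto $\operatorname{Pos}_\bot(\mathbb H)$.
   Context: A graph $\mathbb G$ consists of a vertex set $V^{\mathbb G}$ and an edge set $E^{\mathbb G}$ of two-element subsets of $V^{\mathbb G}$; the edge $\{u,v\}$ is written $uv$. A map $g\colon V^{\mathbb G}\to V^{\mathbb H}$ is a locally surjective homomorphism if (HP) $uv\in E^{\mathbb G}$ implies $g(u)g(v)\in E^{\mathbb H}$, and (BP) for all $u\in V^{\mathbb G}$, $w\in V^{\mathbb H}$ with $g(u)w\in E^{\mathbb H}$ there is $v\in V^{\mathbb G}$ with $uv\in E^{\mathbb G}$ and $g(v)=w$. For posets $\mathbb P,\mathbb Q$, a $p$-morphism is a map $h\colon X^{\mathbb P}\to X^{\mathbb Q}$ such that (HP) $x\leq^{\mathbb P}y$ implies $h(x)\leq^{\mathbb Q}h(y)$, and (BP) whenever $h(x)\leq^{\mathbb Q}y$ there is $z$ with $x\leq^{\mathbb P}z$ and $h(z)=y$. Construction of $\operatorname{Pos}(\mathbb G)$: its carrier is $V\cup V_a\cup V_b\cup E_1\cup E_2\cup\{\top_1,\top_2,\infty_a,\infty_b\}$, where $V=V^{\mathbb G}$, $V_a=\{v_a\}$, $V_b=\{v_b\}$ are disjoint copies of $V$, $E_1=\{e_1\}$, $E_2=\{e_2\}$ are disjoint copies of $E^{\mathbb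 G}$, and $\top_1,\top_2,\infty_a,\infty_b$ are new. The order is the reflexive–transitive closure of the covering relation: $v\prec v_a$, $v\prec v_b$, $v_a\prec\infty_a$, $v_b\prec\infty_b$ for $v\in V$; $e_1\prec\top_1,\ e_1\prec\top_2,\ e_2\prec\top_1,\ e_2\prec\top_2$ for $e\in E^{\mathbb G}$; $v_a,v_b\prec\top_1$ and $v_a,v_b\prec\top_2$ for each isolated vertex $v$; and for each edge $e=uv$, $u_a\prec e_i$, $v_b\prec e_i$, $u_b\prec e_j$, $v_a\prec e_j$ with $\{i,j\}=\{1,2\}$ (the choice of which copy lies above $u_a,v_b$ is arbitrary for each edge). $\operatorname{Pos}_\bot(\mathbb G)$ is obtained from $\operatorname{Pos}(\mathbb G)$ by adding a new least element $\bot$. -}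

module Defs where

open import Data.Product using (Σ; ∃; _×_; _,_)
open import Data.Sum using (_⊎_)
open import Relation.Nullary using (¬_)
open import Relation.Binary.PropositionalEquality using (_≡_; _≢_)
open import Relation.Binary.Construct.Closure.ReflexiveTransitive using (Star)

-- The edge set is a type E whose
-- elements are the edges; each edge e is the two-element set {src e, tgt e}.
-- The pair (src e, tgt e) additionally records an orientation of e, which
-- is used to fix the (arbitrary) choice in the construction of Pos(G):
-- for e with src e = u, tgt e = v we put u_a, v_b below e₁ and u_b, v_a below e₂.
record Graph : Set₁ where
  field
    V    : Set
    E    : Set
    src  : E → V
    tgt  : E → V
    loopless : ∀ e → src e ≢ tgt e
    unique : ∀ e e' →
      ((src e ≡ src e' × tgt e ≡ tgt e') ⊎ (src e ≡ tgt e' × tgt e ≡ src e')) →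
      e ≡ e'

  Adj : V → V → Set
  Adj u v = Σ E λ e → (src e ≡ u × tgt e ≡ v) ⊎ (src e ≡ v × tgt e ≡ u)

  Isolated : V → Set
  Isolated v = ¬ (Σ V λ w → Adj v w)

open Graph public

Surjective : {A B : Set} → (A → B) → Set
Surjective {A} {B} f = ∀ (b : B) → Σ A λ a → f a ≡ b

IsLocSurjHom : (G H : Graph) → (V G → V H) → Set
IsLocSurjHom G H g =
  (∀ u v → Adj G u v → Adj H (g u) (g v)) ×
  (∀ u w → Adj H (g u) w → Σ (V G) λ v → Adj G u v × g v ≡ w)

record Poset' : Set₁ where
  field
    X   : Set
    _≤_ : X → X → Set

IsPMorphism : (P Q : Poset') → (Poset'.X P → Poset'.X Q) → Set
IsPMorphism P Q h =
  (∀ x y → x ≤P y → h x ≤Q h y) ×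
  (∀ x y → h x ≤Q y → Σ (Poset'.X P) λ z → x ≤P z × h z ≡ y)
  where
  open Poset' P renaming (_≤_ to _≤P_)
  open Poset' Q renaming (_≤_ to _≤Q_)

data PosEl (G : Graph) : Set where
  vtx  : V G → PosEl G
  va   : V G → PosEl G
  vb   : V G → PosEl G
  e₁   : E G → PosEl G
  e₂   : E G → PosEl G
  top₁ top₂ ∞a ∞b : PosEl G

data Cover (G : Graph) : PosEl G → PosEl G → Set where
  v≺va  : ∀ v → Cover G (vtx v) (va v)
  v≺vb  : ∀ v → Cover G (vtx v) (vb v)
  va≺∞a : ∀ v → Cover G (va v) ∞a
  vb≺∞b : ∀ v → Cover G (vb v) ∞b
  e₁≺⊤₁ : ∀ e → Cover G (e₁ e) top₁
  e₁≺⊤₂ : ∀ e → Cover G (e₁ e) top₂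
  e₂≺⊤₁ : ∀ e → Cover G (e₂ e) top₁
  e₂≺⊤₂ : ∀ e → Cover G (e₂ e) top₂
  iso-a≺⊤₁ : ∀ v → Isolated G v → Cover G (va v) top₁
  iso-a≺⊤₂ : ∀ v → Isolated G v → Cover G (va v) top₂
  iso-b≺⊤₁ : ∀ v → Isolated G v → Cover G (vb v) top₁
  iso-b≺⊤₂ : ∀ v → Isolated G v → Cover G (vb v) top₂
  srca≺e₁ : ∀ e → Cover G (va (src G e)) (e₁ e)
  tgtb≺e₁ : ∀ e → Cover G (vb (tgt G e)) (e₁ e)
  srcb≺e₂ : ∀ e → Cover G (vb (src G e)) (e₂ e)
  tgta≺e₂ : ∀ e → Cover G (va (tgt G e)) (e₂ e)

Pos : Graph → Poset'
Pos G = record { X = PosEl G ; _≤_ = Star (Cover G) }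

data PosEl⊥ (G : Graph) : Set where
  bot  : PosEl⊥ G
  lift : PosEl G → PosEl⊥ G

data _≤⊥_ {G : Graph} : PosEl⊥ G → PosEl⊥ G → Set where
  bot≤  : ∀ x → bot ≤⊥ x
  lift≤ : ∀ {x y} → Star (Cover G) x y → lift x ≤⊥ lift y

Pos⊥ : Graph → Poset'
Pos⊥ G = record { X = PosEl⊥ G ; _≤_ = _≤⊥_ }

-- A locally surjective homomorphism g induces a map on Pos⊥ that acts on the copies of each
-- vertex and sends the copy of an edge uv lying above u_a and v_b to the copy of g(u)g(v)
-- lying above g(u)_a and g(v)_b; local surjectivity is exactly the back condition at u_a, u_b.
--
-- Conversely, a surjective p-morphism h sends maximal elements to maximal elements and every
-- maximal element has a maximal preimage.  The tops lie (up to double negation) above every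
-- non-maximal element, so they cannot be sent to ∞a or ∞b, and after composing with the
-- symmetry exchanging the a- and b-copies h fixes ∞a and ∞b.  Then h reflects ↓∞a and ↓∞b,
-- so it sends vertices to vertices (this defines g), v_a to g(v)_a, v_b to g(v)_b and edge
-- copies to edge copies.  Reading off the endpoints of the image of an edge copy gives the
-- homomorphism property, and the back condition of h above v gives local surjectivity.
module Submission where

open import Defs
open import Data.Empty using (⊥; ⊥-elim)
open import Data.Product using (Σ; Σ-syntax; _×_; _,_; proj₁; proj₂)
open import Data.Sum using (_⊎_; inj₁; inj₂)
open import Function using (_∘_; case_of_)
open import Function.Bundles using (_⇔_; mk⇔)
open import Relation.Nullary using (¬_)
open import Relation.Binary.PropositionalEquality
  using (_≡_; _≢_; refl; sym; trans; cong; subst; subst₂)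
open import Relation.Binary.Construct.Closure.ReflexiveTransitive
  using (Star; ε; _◅_; _◅◅_; gmap)

SurjectivePMorphism : Poset' → Poset' → Set
SurjectivePMorphism P Q = Σ (Poset'.X P → Poset'.X Q) λ h → Surjective h × IsPMorphism P Q h

∘-surjective-pmorphism : {P Q R : Poset'} →
  SurjectivePMorphism Q R → SurjectivePMorphism P Q → SurjectivePMorphism P R
∘-surjective-pmorphism {P} {Q} {R} (g , g-surj , g-mono , g-back) (f , f-surj , f-mono , f-back) =
  g ∘ f , surj , (λ x y → g-mono (f x) (f y) ∘ f-mono x y) , back
  where
  surj : Surjective (g ∘ f)
  surj z with g-surj z
  ... | y , refl with f-surj y
  ...   | x , refl = x , refl

  back : ∀ x z → Poset'._≤_ R (g (f x)) z →
    Σ[ x' ∈ Poset'.X P ] Poset'._≤_ P x x' × g (f x') ≡ z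
  back x z gfx≤z with g-back (f x) z gfx≤z
  ... | y , fx≤y , refl with f-back x y fx≤y
  ...   | x' , x≤x' , refl = x' , x≤x' , refl

involution-pmorphism : (P : Poset') (f : Poset'.X P → Poset'.X P) → (∀ x → f (f x) ≡ x) →
  (∀ x y → Poset'._≤_ P x y → Poset'._≤_ P (f x) (f y)) → SurjectivePMorphism P P
involution-pmorphism P f f-invol f-mono = f , (λ y → f y , f-invol y) , f-mono , back
  where
  back : ∀ x y → Poset'._≤_ P (f x) y → Σ[ z ∈ Poset'.X P ] Poset'._≤_ P x z × f z ≡ y
  back x y fx≤y =
    f y , subst (λ z → Poset'._≤_ P z (f y)) (f-invol x) (f-mono (f x) y fx≤y) , f-invol y

star-back : {A B : Set} {R : A → A → Set} {S : B → B → Set} {f : A → B} →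
  (∀ a {b} → S (f a) b → Σ[ a' ∈ A ] Star R a a' × f a' ≡ b) →
  ∀ a {b} → Star S (f a) b → Σ[ a' ∈ A ] Star R a a' × f a' ≡ b
star-back back a ε = a , ε , refl
star-back back a (c ◅ s) with back a c
... | a' , r , refl with star-back back a' s
...   | a'' , r' , p = a'' , r ◅◅ r' , p

forward : (K : Graph) (e : E K) → Adj K (src K e) (tgt K e)
forward K e = e , inj₁ (refl , refl)

backward : (K : Graph) (e : E K) → Adj K (tgt K e) (src K e)
backward K e = e , inj₂ (refl , refl)

data Side : Set where
  A B : Side

module _ {K : Graph} where

  infix 4 _≤_
  _≤_ : PosEl K → PosEl K → Set
  _≤_ = Star (Cover K)

  private variable
    u v w : V K
    x y m T : PosEl K

  reverse : Adj K u v → Adj K v u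
  reverse (e , inj₁ p) = e , inj₂ p
  reverse (e , inj₂ p) = e , inj₁ p

  Adj-irrefl : Adj K u v → u ≢ v
  Adj-irrefl (e , inj₁ (refl , refl)) = loopless K e
  Adj-irrefl (e , inj₂ (refl , refl)) = loopless K e ∘ sym

  -- An arc from u to v names the copy of its edge lying above u_a and v_b.
  copy : Adj K u v → PosEl K
  copy (e , inj₁ _) = e₁ e
  copy (e , inj₂ _) = e₂ e

  copy-unique : (a b : Adj K u v) → copy a ≡ copy b
  copy-unique (e , inj₁ (refl , refl)) (f , inj₁ (p , q)) =
    cong e₁ (unique K e f (inj₁ (sym p , sym q)))
  copy-unique (e , inj₂ (refl , refl)) (f , inj₂ (p , q)) =
    cong e₂ (unique K e f (inj₁ (sym p , sym q)))
  copy-unique (e , inj₁ (refl , refl)) (f , inj₂ (p , q))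
    with refl ← unique K e f (inj₂ (sym q , sym p)) = ⊥-elim (loopless K e p)
  copy-unique (e , inj₂ (refl , refl)) (f , inj₁ (p , q))
    with refl ← unique K e f (inj₂ (sym q , sym p)) = ⊥-elim (loopless K e p)

  copy-injective : {u' v' : V K} (a : Adj K u v) (b : Adj K u' v') →
    copy a ≡ copy b → u ≡ u' × v ≡ v'
  copy-injective (e , inj₁ (refl , refl)) (.e , inj₁ (refl , refl)) refl = refl , refl
  copy-injective (e , inj₂ (refl , refl)) (.e , inj₂ (refl , refl)) refl = refl , refl

  tail≺copy : (a : Adj K u v) → Cover K (va u) (copy a)
  tail≺copy (e , inj₁ (refl , refl)) = srca≺e₁ e
  tail≺copy (e , inj₂ (refl , refl)) = tgta≺e₂ e

  head≺copy : (a : Adj K u v) → Cover K (vb v) (copy a)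
  head≺copy (e , inj₁ (refl , refl)) = tgtb≺e₁ e
  head≺copy (e , inj₂ (refl , refl)) = srcb≺e₂ e

  data IsTop : PosEl K → Set where
    ⊤₁ : IsTop top₁
    ⊤₂ : IsTop top₂

  ∞ : Side → PosEl K
  ∞ A = ∞a
  ∞ B = ∞b

  ∞-injective : {s s' : Side} → ∞ s ≡ ∞ s' → s ≡ s'
  ∞-injective {A} {A} _ = refl
  ∞-injective {B} {B} _ = refl

  IsInf : PosEl K → Set
  IsInf x = Σ[ s ∈ Side ] x ≡ ∞ s

  IsMax : PosEl K → Set
  IsMax x = IsTop x ⊎ IsInf x

  top-not-inf : IsTop x → ¬ IsInf x
  top-not-inf ⊤₁ (A , ())
  top-not-inf ⊤₁ (B , ())
  top-not-inf ⊤₂ (A , ())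
  top-not-inf ⊤₂ (B , ())

  copy-not-top : (a : Adj K u v) → ¬ IsTop (copy a)
  copy-not-top (e , inj₁ _) ()
  copy-not-top (e , inj₂ _) ()

  copy≺top : IsTop T → (a : Adj K u v) → Cover K (copy a) T
  copy≺top ⊤₁ (e , inj₁ _) = e₁≺⊤₁ e
  copy≺top ⊤₁ (e , inj₂ _) = e₂≺⊤₁ e
  copy≺top ⊤₂ (e , inj₁ _) = e₁≺⊤₂ e
  copy≺top ⊤₂ (e , inj₂ _) = e₂≺⊤₂ e

  iso-a≺top : IsTop T → Isolated K v → Cover K (va v) T
  iso-a≺top ⊤₁ = iso-a≺⊤₁ _
  iso-a≺top ⊤₂ = iso-a≺⊤₂ _

  iso-b≺top : IsTop T → Isolated K v → Cover K (vb v) T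
  iso-b≺top ⊤₁ = iso-b≺⊤₁ _
  iso-b≺top ⊤₂ = iso-b≺⊤₂ _

  vtx-injective : _≡_ {A = PosEl K} (vtx u) (vtx w) → u ≡ w
  vtx-injective refl = refl

  vtx≤∞a : (v : V K) → vtx v ≤ ∞a
  vtx≤∞a v = v≺va v ◅ va≺∞a v ◅ ε

  vtx≤∞b : (v : V K) → vtx v ≤ ∞b
  vtx≤∞b v = v≺vb v ◅ vb≺∞b v ◅ ε

  max-up : IsMax m → m ≤ y → y ≡ m
  max-up _ ε = refl
  max-up (inj₁ ⊤₁) (() ◅ _)
  max-up (inj₁ ⊤₂) (() ◅ _)
  max-up (inj₂ (A , refl)) (() ◅ _)
  max-up (inj₂ (B , refl)) (() ◅ _)

  ∞-not-below-top : (s : Side) → IsTop T → ¬ ∞ s ≤ T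
  ∞-not-below-top s t ∞≤T =
    top-not-inf (subst IsTop (max-up (inj₂ (s , refl)) ∞≤T) t) (s , refl)

  data Shape (x : PosEl K) : Set where
    below-∞ : (s : Side) → x ≤ ∞ s → Shape x
    top     : IsTop x → Shape x
    edge    : {u v : V K} (c : Adj K u v) → x ≡ copy c → Shape x

  shape : (x : PosEl K) → Shape x
  shape (vtx v) = below-∞ A (vtx≤∞a v)
  shape (va v)  = below-∞ A (va≺∞a v ◅ ε)
  shape (vb v)  = below-∞ B (vb≺∞b v ◅ ε)
  shape (e₁ e)  = edge (forward K e) refl
  shape (e₂ e)  = edge (backward K e) refl
  shape top₁    = top ⊤₁
  shape top₂    = top ⊤₂
  shape ∞a      = below-∞ A ε
  shape ∞b      = below-∞ B ε

  below-max : (x : PosEl K) → Σ[ m ∈ PosEl K ] IsMax m × x ≤ m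
  below-max x with shape x
  ... | below-∞ s x≤∞ = ∞ s , inj₂ (s , refl) , x≤∞
  ... | top t         = x , inj₁ t , ε
  ... | edge c refl   = top₁ , inj₁ ⊤₁ , copy≺top ⊤₁ c ◅ ε

  -- Whether v is isolated is undecidable, but in either case v_a lies below every top.
  va-below-top : IsTop T → (v : V K) → ¬ ¬ va v ≤ T
  va-below-top t v k = k (iso-a≺top t (λ (w , a) → k (tail≺copy a ◅ copy≺top t a ◅ ε)) ◅ ε)

  vb-below-top : IsTop T → (v : V K) → ¬ ¬ vb v ≤ T
  vb-below-top t v k =
    k (iso-b≺top t (λ (w , a) → k (head≺copy (reverse a) ◅ copy≺top t (reverse a) ◅ ε)) ◅ ε)

  non-max-below-top : IsTop T → (x : PosEl K) → IsMax x ⊎ ¬ ¬ x ≤ T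
  non-max-below-top t (vtx v) = inj₂ λ k → va-below-top t v (k ∘ (v≺va v ◅_))
  non-max-below-top t (va v)  = inj₂ (va-below-top t v)
  non-max-below-top t (vb v)  = inj₂ (vb-below-top t v)
  non-max-below-top t (e₁ e)  = inj₂ λ k → k (copy≺top t (forward K e) ◅ ε)
  non-max-below-top t (e₂ e)  = inj₂ λ k → k (copy≺top t (backward K e) ◅ ε)
  non-max-below-top t top₁    = inj₁ (inj₁ ⊤₁)
  non-max-below-top t top₂    = inj₁ (inj₁ ⊤₂)
  non-max-below-top t ∞a      = inj₁ (inj₂ (A , refl))
  non-max-below-top t ∞b      = inj₁ (inj₂ (B , refl))

  downward : {P : PosEl K → Set} → (∀ {x y} → P y → Cover K x y → P x) → x ≤ y → P y → P x
  downward step ε p = p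
  downward step (c ◅ s) p = step (downward step s p) c

  data ↓∞a : PosEl K → Set where
    vtx : (v : V K) → ↓∞a (vtx v)
    va  : (v : V K) → ↓∞a (va v)
    ∞a  : ↓∞a ∞a

  below-∞a : x ≤ ∞a → ↓∞a x
  below-∞a x≤∞a = downward step x≤∞a ∞a
    where
    step : ↓∞a y → Cover K x y → ↓∞a x
    step (va _) (v≺va v) = vtx v
    step ∞a (va≺∞a v)    = va v
    step (vtx _) ()

  data ↓∞b : PosEl K → Set where
    vtx : (v : V K) → ↓∞b (vtx v)
    vb  : (v : V K) → ↓∞b (vb v)
    ∞b  : ↓∞b ∞b

  below-∞b : x ≤ ∞b → ↓∞b x
  below-∞b x≤∞b = downward step x≤∞b ∞b
    where
    step : ↓∞b y → Cover K x y → ↓∞b x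
    step (vb _) (v≺vb v) = vtx v
    step ∞b (vb≺∞b v)    = vb v
    step (vtx _) ()

  below-∞a-∞b : x ≤ ∞a → x ≤ ∞b → Σ[ u ∈ V K ] x ≡ vtx u
  below-∞a-∞b x≤∞a x≤∞b with below-∞a x≤∞a | below-∞b x≤∞b
  ... | vtx u | _ = u , refl
  ... | va _  | ()
  ... | ∞a    | ()

  non-max-outside-↓∞ : V K → (s : Side) → Σ[ y ∈ PosEl K ] ¬ IsMax y × ¬ y ≤ ∞ s
  non-max-outside-↓∞ w A =
    vb w , (λ { (inj₁ ()) ; (inj₂ (A , ())) ; (inj₂ (B , ())) }) , λ le → case below-∞a le of λ ()
  non-max-outside-↓∞ w B =
    va w , (λ { (inj₁ ()) ; (inj₂ (A , ())) ; (inj₂ (B , ())) }) , λ le → case below-∞b le of λ ()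

  copy-not-below-∞ : (s : Side) (a : Adj K u v) → ¬ copy a ≤ ∞ s
  copy-not-below-∞ A (e , inj₁ _) le = case below-∞a le of λ ()
  copy-not-below-∞ A (e , inj₂ _) le = case below-∞a le of λ ()
  copy-not-below-∞ B (e , inj₁ _) le = case below-∞b le of λ ()
  copy-not-below-∞ B (e , inj₂ _) le = case below-∞b le of λ ()

  below-vtx : x ≤ vtx w → x ≡ vtx w
  below-vtx ε = refl
  below-vtx (c ◅ s) with refl ← below-vtx s = case c of λ ()

  data ↓va (w : V K) : PosEl K → Set where
    vtx : ↓va w (vtx w)
    va  : ↓va w (va w)

  below-va : x ≤ va w → ↓va w x
  below-va {w = w} x≤va = downward step x≤va va
    where
    step : ↓va w y → Cover K x y → ↓va w x
    step va (v≺va _) = vtx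
    step vtx ()

  vtx≤va : vtx u ≤ va w → u ≡ w
  vtx≤va le with below-va le
  ... | vtx = refl

  data ↓vb (w : V K) : PosEl K → Set where
    vtx : ↓vb w (vtx w)
    vb  : ↓vb w (vb w)

  below-vb : x ≤ vb w → ↓vb w x
  below-vb {w = w} x≤vb = downward step x≤vb vb
    where
    step : ↓vb w y → Cover K x y → ↓vb w x
    step vb (v≺vb _) = vtx
    step vtx ()

  vtx≤vb : vtx u ≤ vb w → u ≡ w
  vtx≤vb le with below-vb le
  ... | vtx = refl

  vtx≤y≤∞a⇒y≡va : vtx w ≤ y → y ≤ ∞a → ¬ y ≤ ∞b → y ≢ ∞a → y ≡ va w
  vtx≤y≤∞a⇒y≡va w≤y y≤∞a y≰∞b y≢∞a with below-∞a y≤∞a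
  ... | vtx u = ⊥-elim (y≰∞b (vtx≤∞b u))
  ... | va u  = cong va (sym (vtx≤va w≤y))
  ... | ∞a    = ⊥-elim (y≢∞a refl)

  vtx≤y≤∞b⇒y≡vb : vtx w ≤ y → y ≤ ∞b → ¬ y ≤ ∞a → y ≢ ∞b → y ≡ vb w
  vtx≤y≤∞b⇒y≡vb w≤y y≤∞b y≰∞a y≢∞b with below-∞b y≤∞b
  ... | vtx u = ⊥-elim (y≰∞a (vtx≤∞a u))
  ... | vb u  = cong vb (sym (vtx≤vb w≤y))
  ... | ∞b    = ⊥-elim (y≢∞b refl)

  data ↓copy {u v : V K} (a : Adj K u v) : PosEl K → Set where
    tail   : ↓copy a (vtx u)
    head   : ↓copy a (vtx v)
    tail-a : ↓copy a (va u)
    head-b : ↓copy a (vb v)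
    self   : ↓copy a (copy a)

  below-copy : (a : Adj K u v) → x ≤ copy a → ↓copy a x
  below-copy a x≤a = downward (step a) x≤a self
    where
    step : (a : Adj K u v) → ↓copy a y → Cover K x y → ↓copy a x
    step (e , inj₁ (refl , refl)) self (srca≺e₁ _) = tail-a
    step (e , inj₁ (refl , refl)) self (tgtb≺e₁ _) = head-b
    step (e , inj₂ (refl , refl)) self (tgta≺e₂ _) = tail-a
    step (e , inj₂ (refl , refl)) self (srcb≺e₂ _) = head-b
    step (e , _) tail-a (v≺va _) = tail
    step (e , _) head-b (v≺vb _) = head

  vtx≤copy : (a : Adj K u v) → vtx w ≤ copy a → w ≡ u ⊎ w ≡ v
  vtx≤copy a@(e , inj₁ (refl , refl)) le with below-copy a le
  ... | tail = inj₁ refl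
  ... | head = inj₂ refl
  vtx≤copy a@(e , inj₂ (refl , refl)) le with below-copy a le
  ... | tail = inj₁ refl
  ... | head = inj₂ refl

  va≤copy : (a : Adj K u v) → va w ≤ copy a → w ≡ u
  va≤copy a@(e , inj₁ (refl , refl)) le with below-copy a le
  ... | tail-a = refl
  va≤copy a@(e , inj₂ (refl , refl)) le with below-copy a le
  ... | tail-a = refl

  vb≤copy : (a : Adj K u v) → vb w ≤ copy a → w ≡ v
  vb≤copy a@(e , inj₁ (refl , refl)) le with below-copy a le
  ... | head-b = refl
  vb≤copy a@(e , inj₂ (refl , refl)) le with below-copy a le
  ... | head-b = refl

  data VaCover (x : V K) : PosEl K → Set where
    to-∞    : VaCover x ∞a
    to-top  : IsTop T → Isolated K x → VaCover x T
    to-copy : (a : Adj K x w) → VaCover x (copy a)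

  va-cover-inv : Cover K (va u) y → VaCover u y
  va-cover-inv (va≺∞a _)      = to-∞
  va-cover-inv (iso-a≺⊤₁ _ i) = to-top ⊤₁ i
  va-cover-inv (iso-a≺⊤₂ _ i) = to-top ⊤₂ i
  va-cover-inv (srca≺e₁ e)    = to-copy (forward K e)
  va-cover-inv (tgta≺e₂ e)    = to-copy (backward K e)

  data VbCover (x : V K) : PosEl K → Set where
    to-∞    : VbCover x ∞b
    to-top  : IsTop T → Isolated K x → VbCover x T
    to-copy : (a : Adj K w x) → VbCover x (copy a)

  vb-cover-inv : Cover K (vb u) y → VbCover u y
  vb-cover-inv (vb≺∞b _)      = to-∞
  vb-cover-inv (iso-b≺⊤₁ _ i) = to-top ⊤₁ i
  vb-cover-inv (iso-b≺⊤₂ _ i) = to-top ⊤₂ i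
  vb-cover-inv (tgtb≺e₁ e)    = to-copy (forward K e)
  vb-cover-inv (srcb≺e₂ e)    = to-copy (backward K e)

  copy-cover-inv : (a : Adj K u v) → Cover K (copy a) y → IsTop y
  copy-cover-inv (e , inj₁ _) (e₁≺⊤₁ _) = ⊤₁
  copy-cover-inv (e , inj₁ _) (e₁≺⊤₂ _) = ⊤₂
  copy-cover-inv (e , inj₂ _) (e₂≺⊤₁ _) = ⊤₁
  copy-cover-inv (e , inj₂ _) (e₂≺⊤₂ _) = ⊤₂

lift-injective : {K : Graph} {x y : PosEl K} → _≡_ {A = PosEl⊥ K} (lift x) (lift y) → x ≡ y
lift-injective refl = refl

unlift : {K : Graph} {x y : PosEl K} → lift x ≤⊥ lift y → x ≤ y
unlift (lift≤ s) = s

≤⊥-bot : {K : Graph} {x : PosEl⊥ K} → x ≤⊥ bot → x ≡ bot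
≤⊥-bot (bot≤ _) = refl

max-up⊥ : {K : Graph} {m : PosEl K} {y : PosEl⊥ K} → IsMax m → lift m ≤⊥ y → y ≡ lift m
max-up⊥ im (lift≤ s) = cong lift (max-up im s)

below-max⊥ : {K : Graph} (x : PosEl⊥ K) → Σ[ m ∈ PosEl K ] IsMax m × x ≤⊥ lift m
below-max⊥ bot      = ∞a , inj₂ (A , refl) , bot≤ _
below-max⊥ (lift x) = let (m , im , x≤m) = below-max x in m , im , lift≤ x≤m

map⊥ : {G H : Graph} → (PosEl G → PosEl H) → PosEl⊥ G → PosEl⊥ H
map⊥ f bot      = bot
map⊥ f (lift x) = lift (f x)

module _ {G H : Graph} (f : PosEl G → PosEl H) (f-mono : ∀ {x y} → x ≤ y → f x ≤ f y) where

  map⊥-mono : ∀ x y → x ≤⊥ y → map⊥ f x ≤⊥ map⊥ f y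
  map⊥-mono _ _ (bot≤ _)  = bot≤ _
  map⊥-mono _ _ (lift≤ s) = lift≤ (f-mono s)

  map⊥-pmorphism : Surjective f → (∀ x {y} → f x ≤ y → Σ[ z ∈ PosEl G ] x ≤ z × f z ≡ y) →
    SurjectivePMorphism (Pos⊥ G) (Pos⊥ H)
  map⊥-pmorphism f-surj f-back = map⊥ f , surj , map⊥-mono , back
    where
    surj : Surjective (map⊥ f)
    surj bot      = bot , refl
    surj (lift y) = let (x , p) = f-surj y in lift x , cong lift p

    back : ∀ x y → map⊥ f x ≤⊥ y → Σ[ z ∈ PosEl⊥ G ] x ≤⊥ z × map⊥ f z ≡ y
    back bot y _ = let (z , p) = surj y in z , bot≤ z , p
    back (lift x) (lift y) (lift≤ s) =
      let (z , x≤z , p) = f-back x s in lift z , lift≤ x≤z , cong lift p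

-- From a locally surjective homomorphism to a p-morphism

module FromLocSurjHom {G H : Graph} (g : V G → V H) (g-surj : Surjective g)
  (g-lsh : IsLocSurjHom G H g) where

  private variable
    u v : V G
    x y : PosEl G

  ĝ : Adj G u v → Adj H (g u) (g v)
  ĝ = proj₁ g-lsh _ _

  g-back : ∀ u w → Adj H (g u) w → Σ[ v ∈ V G ] Adj G u v × g v ≡ w
  g-back = proj₂ g-lsh

  isolated-preserve : Isolated G v → Isolated H (g v)
  isolated-preserve i (w , b) = let (v' , a , _) = g-back _ w b in i (v' , a)

  isolated-reflect : Isolated H (g v) → Isolated G v
  isolated-reflect i (w , a) = i (g w , ĝ a)

  h₀ : PosEl G → PosEl H
  h₀ (vtx v) = vtx (g v)
  h₀ (va v)  = va (g v)
  h₀ (vb v)  = vb (g v)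
  h₀ (e₁ e)  = copy (ĝ (forward G e))
  h₀ (e₂ e)  = copy (ĝ (backward G e))
  h₀ top₁    = top₁
  h₀ top₂    = top₂
  h₀ ∞a      = ∞a
  h₀ ∞b      = ∞b

  h₀-copy : (a : Adj G u v) → h₀ (copy a) ≡ copy (ĝ a)
  h₀-copy (e , inj₁ (refl , refl)) = refl
  h₀-copy (e , inj₂ (refl , refl)) = refl

  top-preimage : {y : PosEl H} → IsTop y → Σ[ T ∈ PosEl G ] IsTop T × h₀ T ≡ y
  top-preimage ⊤₁ = top₁ , ⊤₁ , refl
  top-preimage ⊤₂ = top₂ , ⊤₂ , refl

  h₀-cover : Cover G x y → Cover H (h₀ x) (h₀ y)
  h₀-cover (v≺va v)       = v≺va (g v)
  h₀-cover (v≺vb v)       = v≺vb (g v)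
  h₀-cover (va≺∞a v)      = va≺∞a (g v)
  h₀-cover (vb≺∞b v)      = vb≺∞b (g v)
  h₀-cover (e₁≺⊤₁ e)      = copy≺top ⊤₁ (ĝ (forward G e))
  h₀-cover (e₁≺⊤₂ e)      = copy≺top ⊤₂ (ĝ (forward G e))
  h₀-cover (e₂≺⊤₁ e)      = copy≺top ⊤₁ (ĝ (backward G e))
  h₀-cover (e₂≺⊤₂ e)      = copy≺top ⊤₂ (ĝ (backward G e))
  h₀-cover (iso-a≺⊤₁ v i) = iso-a≺⊤₁ (g v) (isolated-preserve i)
  h₀-cover (iso-a≺⊤₂ v i) = iso-a≺⊤₂ (g v) (isolated-preserve i)
  h₀-cover (iso-b≺⊤₁ v i) = iso-b≺⊤₁ (g v) (isolated-preserve i)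
  h₀-cover (iso-b≺⊤₂ v i) = iso-b≺⊤₂ (g v) (isolated-preserve i)
  h₀-cover (srca≺e₁ e)    = tail≺copy (ĝ (forward G e))
  h₀-cover (tgtb≺e₁ e)    = head≺copy (ĝ (forward G e))
  h₀-cover (srcb≺e₂ e)    = head≺copy (ĝ (backward G e))
  h₀-cover (tgta≺e₂ e)    = tail≺copy (ĝ (backward G e))

  h₀-back-cover-copy : (a : Adj G u v) {y : PosEl H} → Cover H (copy (ĝ a)) y →
    Σ[ z ∈ PosEl G ] copy a ≤ z × h₀ z ≡ y
  h₀-back-cover-copy a c =
    let (T , t , p) = top-preimage (copy-cover-inv (ĝ a) c) in T , copy≺top t a ◅ ε , p

  h₀-back-cover : ∀ x {y} → Cover H (h₀ x) y → Σ[ z ∈ PosEl G ] x ≤ z × h₀ z ≡ y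
  h₀-back-cover (vtx v) (v≺va _) = va v , v≺va v ◅ ε , refl
  h₀-back-cover (vtx v) (v≺vb _) = vb v , v≺vb v ◅ ε , refl
  h₀-back-cover (va v) c with va-cover-inv c
  ... | to-∞ = ∞a , va≺∞a v ◅ ε , refl
  ... | to-top t i =
    let (T , t' , p) = top-preimage t in T , iso-a≺top t' (isolated-reflect i) ◅ ε , p
  ... | to-copy b with g-back v _ b
  ...   | _ , a , refl = copy a , tail≺copy a ◅ ε , trans (h₀-copy a) (copy-unique (ĝ a) b)
  h₀-back-cover (vb v) c with vb-cover-inv c
  ... | to-∞ = ∞b , vb≺∞b v ◅ ε , refl
  ... | to-top t i =
    let (T , t' , p) = top-preimage t in T , iso-b≺top t' (isolated-reflect i) ◅ ε , p
  ... | to-copy b with g-back v _ (reverse {H} b)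
  ...   | _ , a , refl =
    let a⁻ = reverse {G} a
    in copy a⁻ , head≺copy a⁻ ◅ ε , trans (h₀-copy a⁻) (copy-unique (ĝ a⁻) b)
  h₀-back-cover (e₁ e) c = h₀-back-cover-copy (forward G e) c
  h₀-back-cover (e₂ e) c = h₀-back-cover-copy (backward G e) c

  copy-in-image : {w₁ w₂ : V H} (b : Adj H w₁ w₂) → Σ[ z ∈ PosEl G ] h₀ z ≡ copy b
  copy-in-image {w₁} b with g-surj w₁
  ... | u , refl with g-back u _ b
  ...   | _ , a , refl = copy a , trans (h₀-copy a) (copy-unique (ĝ a) b)

  h₀-surj : Surjective h₀
  h₀-surj (vtx w) = let (v , p) = g-surj w in vtx v , cong vtx p
  h₀-surj (va w)  = let (v , p) = g-surj w in va v , cong va p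
  h₀-surj (vb w)  = let (v , p) = g-surj w in vb v , cong vb p
  h₀-surj (e₁ f)  = copy-in-image (forward H f)
  h₀-surj (e₂ f)  = copy-in-image (backward H f)
  h₀-surj top₁    = top₁ , refl
  h₀-surj top₂    = top₂ , refl
  h₀-surj ∞a      = ∞a , refl
  h₀-surj ∞b      = ∞b , refl

  pmorphism : SurjectivePMorphism (Pos⊥ G) (Pos⊥ H)
  pmorphism = map⊥-pmorphism h₀ (gmap h₀ h₀-cover) h₀-surj (star-back h₀-back-cover)

-- The symmetry exchanging the a- and b-copies

module _ {K : Graph} where

  swap : PosEl K → PosEl K
  swap (vtx v) = vtx v
  swap (va v)  = vb v
  swap (vb v)  = va v
  swap (e₁ e)  = e₂ e
  swap (e₂ e)  = e₁ e
  swap top₁    = top₁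
  swap top₂    = top₂
  swap ∞a      = ∞b
  swap ∞b      = ∞a

  swap-cover : {x y : PosEl K} → Cover K x y → Cover K (swap x) (swap y)
  swap-cover (v≺va v)       = v≺vb v
  swap-cover (v≺vb v)       = v≺va v
  swap-cover (va≺∞a v)      = vb≺∞b v
  swap-cover (vb≺∞b v)      = va≺∞a v
  swap-cover (e₁≺⊤₁ e)      = e₂≺⊤₁ e
  swap-cover (e₁≺⊤₂ e)      = e₂≺⊤₂ e
  swap-cover (e₂≺⊤₁ e)      = e₁≺⊤₁ e
  swap-cover (e₂≺⊤₂ e)      = e₁≺⊤₂ e
  swap-cover (iso-a≺⊤₁ v i) = iso-b≺⊤₁ v i
  swap-cover (iso-a≺⊤₂ v i) = iso-b≺⊤₂ v i
  swap-cover (iso-b≺⊤₁ v i) = iso-a≺⊤₁ v i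
  swap-cover (iso-b≺⊤₂ v i) = iso-a≺⊤₂ v i
  swap-cover (srca≺e₁ e)    = srcb≺e₂ e
  swap-cover (tgtb≺e₁ e)    = tgta≺e₂ e
  swap-cover (srcb≺e₂ e)    = srca≺e₁ e
  swap-cover (tgta≺e₂ e)    = tgtb≺e₁ e

  swap⊥-involutive : (x : PosEl⊥ K) → map⊥ swap (map⊥ swap x) ≡ x
  swap⊥-involutive bot            = refl
  swap⊥-involutive (lift (vtx v)) = refl
  swap⊥-involutive (lift (va v))  = refl
  swap⊥-involutive (lift (vb v))  = refl
  swap⊥-involutive (lift (e₁ e))  = refl
  swap⊥-involutive (lift (e₂ e))  = refl
  swap⊥-involutive (lift top₁)    = refl
  swap⊥-involutive (lift top₂)    = refl
  swap⊥-involutive (lift ∞a)      = refl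
  swap⊥-involutive (lift ∞b)      = refl

  swap-pmorphism : SurjectivePMorphism (Pos⊥ K) (Pos⊥ K)
  swap-pmorphism = involution-pmorphism (Pos⊥ K) (map⊥ swap) swap⊥-involutive
    (map⊥-mono swap (gmap swap swap-cover))

-- From a p-morphism to a locally surjective homomorphism

module ToLocSurjHom {G H : Graph} (w₀ : V H) (h : PosEl⊥ G → PosEl⊥ H)
  (h-surj : Surjective h) (h-pmor : IsPMorphism (Pos⊥ G) (Pos⊥ H) h) where

  private variable
    u v : V G
    x : PosEl G
    T : PosEl G

  h-mono : ∀ x y → x ≤⊥ y → h x ≤⊥ h y
  h-mono = proj₁ h-pmor

  h-back : ∀ x y → h x ≤⊥ y → Σ[ z ∈ PosEl⊥ G ] x ≤⊥ z × h z ≡ y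
  h-back = proj₂ h-pmor

  h-bot : h bot ≡ bot
  h-bot = let (z , p) = h-surj bot in ≤⊥-bot (subst (h bot ≤⊥_) p (h-mono bot z (bot≤ z)))

  h-bot≢lift : {y : PosEl H} → h bot ≢ lift y
  h-bot≢lift p = case trans (sym h-bot) p of λ ()

  max-image : {m : PosEl G} → IsMax m → Σ[ m' ∈ PosEl H ] IsMax m' × h (lift m) ≡ lift m'
  max-image {m} im =
    let (m' , im' , hm≤m') = below-max⊥ (h (lift m))
        (z , m≤z , p) = h-back (lift m) (lift m') hm≤m'
    in m' , im' , trans (cong h (sym (max-up⊥ im m≤z))) p

  max-preimage : {m' : PosEl H} → IsMax m' → Σ[ m ∈ PosEl G ] IsMax m × h (lift m) ≡ lift m'
  max-preimage im' =
    let (z , p) = h-surj (lift _)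
        (m , im , z≤m) = below-max⊥ z
    in m , im , max-up⊥ im' (subst (_≤⊥ h (lift m)) p (h-mono z (lift m) z≤m))

  image-below-top : IsTop T → (y : PosEl H) → ¬ IsMax y → ¬ ¬ lift y ≤⊥ h (lift T)
  image-below-top {T} t y y-not-max with h-surj (lift y)
  ... | bot , p = ⊥-elim (h-bot≢lift p)
  ... | lift x , p with non-max-below-top t x
  ...   | inj₁ x-max =
    let (m' , im' , q) = max-image x-max
    in ⊥-elim (y-not-max (subst IsMax (lift-injective (trans (sym q) p)) im'))
  ...   | inj₂ x≤T =
    λ y≰hT → x≤T λ x≤T → y≰hT (subst (_≤⊥ h (lift T)) p (h-mono _ _ (lift≤ x≤T)))

  -- An infinity of H has non-maximal elements outside its down-set, so it cannot lie above
  -- the whole image of the non-maximal elements, as the image of a top does.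
  top-image : IsTop T → Σ[ T' ∈ PosEl H ] IsTop T' × h (lift T) ≡ lift T'
  top-image t with max-image (inj₁ t)
  ... | T' , inj₁ t' , p = T' , t' , p
  ... | _ , inj₂ (s , refl) , p =
    let (y , y-not-max , y≰∞) = non-max-outside-↓∞ w₀ s
    in ⊥-elim (image-below-top t y y-not-max λ le → y≰∞ (unlift (subst (lift y ≤⊥_) p le)))

  top-image≢∞ : IsTop T → (s : Side) → h (lift T) ≢ lift (∞ s)
  top-image≢∞ t s p =
    let (T' , t' , q) = top-image t
    in top-not-inf (subst IsTop (lift-injective (trans (sym q) p)) t') (s , refl)

  ∞-preimage : (s : Side) → Σ[ s' ∈ Side ] h (lift (∞ s')) ≡ lift (∞ s)
  ∞-preimage s with max-preimage (inj₂ (s , refl))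
  ... | _ , inj₂ (s' , refl) , p = s' , p
  ... | _ , inj₁ t , p = ⊥-elim (top-image≢∞ t s p)

  orientation : (h (lift ∞a) ≡ lift ∞a × h (lift ∞b) ≡ lift ∞b)
              ⊎ (h (lift ∞a) ≡ lift ∞b × h (lift ∞b) ≡ lift ∞a)
  orientation with ∞-preimage A | ∞-preimage B
  ... | A , p | B , q = inj₁ (p , q)
  ... | B , p | A , q = inj₂ (q , p)
  ... | A , p | A , q = ⊥-elim (case trans (sym p) q of λ ())
  ... | B , p | B , q = ⊥-elim (case trans (sym p) q of λ ())

  module WithFixedInfinities (h-∞ : ∀ s → h (lift (∞ s)) ≡ lift (∞ s)) where

    reflect-∞ : (s : Side) → h (lift x) ≡ lift (∞ s) → x ≡ ∞ s
    reflect-∞ {x} s p with non-max-below-top ⊤₁ x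
    ... | inj₁ (inj₂ (s' , refl)) =
      cong ∞ (∞-injective (lift-injective (trans (sym (h-∞ s')) p)))
    ... | inj₁ (inj₁ t) = ⊥-elim (top-image≢∞ t s p)
    ... | inj₂ x≤⊤₁ = ⊥-elim (x≤⊤₁ λ x≤⊤₁ →
      let (T , t , q) = top-image ⊤₁
      in ∞-not-below-top s t (unlift (subst₂ _≤⊥_ p q (h-mono _ _ (lift≤ x≤⊤₁)))))

    reflect-below-∞ : (s : Side) {x : PosEl⊥ G} → h x ≤⊥ lift (∞ s) → x ≤⊥ lift (∞ s)
    reflect-below-∞ s hx≤∞ with h-back _ _ hx≤∞
    ... | bot , _ , p = ⊥-elim (h-bot≢lift p)
    ... | lift z , x≤z , p = subst (λ z → _ ≤⊥ lift z) (reflect-∞ s p) x≤z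

    vertex-preimage : {x : PosEl⊥ G} {w : V H} → h x ≡ lift (vtx w) →
      Σ[ u ∈ V G ] x ≡ lift (vtx u)
    vertex-preimage {bot} p = ⊥-elim (h-bot≢lift p)
    vertex-preimage {lift x} {w} p =
      let x≤∞ s w≤∞ = unlift (reflect-below-∞ s (subst (_≤⊥ _) (sym p) (lift≤ w≤∞)))
          (u , q) = below-∞a-∞b (x≤∞ A (vtx≤∞a w)) (x≤∞ B (vtx≤∞b w))
      in u , cong lift q

    -- If h x were ⊥, the back condition would put above x an element sent to the vertex w₀;
    -- that element is a vertex, hence equal to x, and then h x would be w₀ after all.
    lift-image : (x : PosEl G) → Σ[ y ∈ PosEl H ] h (lift x) ≡ lift y
    lift-image x with h (lift x) in p
    ... | lift y = y , refl
    ... | bot with h-back (lift x) (lift (vtx w₀)) (subst (_≤⊥ _) (sym p) (bot≤ _))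
    ...   | z , x≤z , q with vertex-preimage q
    ...     | u , refl with refl ← below-vtx (unlift x≤z) = case trans (sym p) q of λ ()

    h₀ : PosEl G → PosEl H
    h₀ x = proj₁ (lift-image x)

    h₀-lift : h (lift x) ≡ lift (h₀ x)
    h₀-lift {x} = proj₂ (lift-image x)

    h₀-mono : {x y : PosEl G} → x ≤ y → h₀ x ≤ h₀ y
    h₀-mono x≤y = unlift (subst₂ _≤⊥_ h₀-lift h₀-lift (h-mono _ _ (lift≤ x≤y)))

    h₀-back : {y : PosEl H} → h₀ x ≤ y → Σ[ z ∈ PosEl G ] x ≤ z × h₀ z ≡ y
    h₀-back {x} hx≤y with h-back (lift x) _ (subst (_≤⊥ _) (sym h₀-lift) (lift≤ hx≤y))
    ... | lift z , lift≤ x≤z , p = z , x≤z , lift-injective (trans (sym h₀-lift) p)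

    h₀-surj : Surjective h₀
    h₀-surj y with h-surj (lift y)
    ... | bot , p    = ⊥-elim (h-bot≢lift p)
    ... | lift x , p = x , lift-injective (trans (sym h₀-lift) p)

    h₀-∞ : (s : Side) → h₀ (∞ s) ≡ ∞ s
    h₀-∞ s = lift-injective (trans (sym h₀-lift) (h-∞ s))

    h₀-below-∞ : (s : Side) → x ≤ ∞ s → h₀ x ≤ ∞ s
    h₀-below-∞ s x≤∞ = subst (h₀ _ ≤_) (h₀-∞ s) (h₀-mono x≤∞)

    h₀-reflect-below-∞ : (s : Side) → h₀ x ≤ ∞ s → x ≤ ∞ s
    h₀-reflect-below-∞ s hx≤∞ =
      unlift (reflect-below-∞ s (subst (_≤⊥ _) (sym h₀-lift) (lift≤ hx≤∞)))

    h₀-reflect-∞ : (s : Side) → h₀ x ≡ ∞ s → x ≡ ∞ s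
    h₀-reflect-∞ s p = reflect-∞ s (trans h₀-lift (cong lift p))

    h₀-top : IsTop T → IsTop (h₀ T)
    h₀-top t =
      let (T' , t' , p) = top-image t in subst IsTop (lift-injective (trans (sym p) h₀-lift)) t'

    top-preimage : {T' : PosEl H} → IsTop T' → Σ[ T ∈ PosEl G ] IsTop T × h₀ T ≡ T'
    top-preimage t' with max-preimage (inj₁ t')
    ... | T , inj₁ t , q = T , t , lift-injective (trans (sym h₀-lift) q)
    ... | _ , inj₂ (s , refl) , q =
      ⊥-elim (top-not-inf (subst IsTop (lift-injective (trans (sym q) (h-∞ s))) t') (s , refl))

    tops-distinct : h₀ top₁ ≢ h₀ top₂
    tops-distinct p =
      let (T₁ , t₁ , q₁) = top-preimage ⊤₁
          (T₂ , t₂ , q₂) = top-preimage ⊤₂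
      in case trans (sym q₁) (trans (constant t₁) (trans (sym (constant t₂)) q₂)) of λ ()
      where
      constant : IsTop T → h₀ T ≡ h₀ top₁
      constant ⊤₁ = refl
      constant ⊤₂ = sym p

    h₀-vtx-is-vtx : (v : V G) → Σ[ w ∈ V H ] h₀ (vtx v) ≡ vtx w
    h₀-vtx-is-vtx v = below-∞a-∞b (h₀-below-∞ A (vtx≤∞a v)) (h₀-below-∞ B (vtx≤∞b v))

    g : V G → V H
    g v = proj₁ (h₀-vtx-is-vtx v)

    h₀-vtx : h₀ (vtx v) ≡ vtx (g v)
    h₀-vtx {v} = proj₂ (h₀-vtx-is-vtx v)

    g-surj : Surjective g
    g-surj w with h₀-surj (vtx w)
    ... | x , p with below-∞a-∞b (h₀-reflect-below-∞ A (subst (_≤ ∞a) (sym p) (vtx≤∞a w)))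
                                 (h₀-reflect-below-∞ B (subst (_≤ ∞b) (sym p) (vtx≤∞b w)))
    ...   | u , refl = u , vtx-injective (trans (sym h₀-vtx) p)

    h₀-above-vtx : vtx v ≤ x → vtx (g v) ≤ h₀ x
    h₀-above-vtx v≤x = subst (_≤ h₀ _) h₀-vtx (h₀-mono v≤x)

    h₀-va : h₀ (va v) ≡ va (g v)
    h₀-va {v} = vtx≤y≤∞a⇒y≡va (h₀-above-vtx (v≺va v ◅ ε)) (h₀-below-∞ A (va≺∞a v ◅ ε))
      (λ le → case below-∞b (h₀-reflect-below-∞ B le) of λ ())
      (λ p → case h₀-reflect-∞ A p of λ ())

    h₀-vb : h₀ (vb v) ≡ vb (g v)
    h₀-vb {v} = vtx≤y≤∞b⇒y≡vb (h₀-above-vtx (v≺vb v ◅ ε)) (h₀-below-∞ B (vb≺∞b v ◅ ε))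
      (λ le → case below-∞a (h₀-reflect-below-∞ A le) of λ ())
      (λ p → case h₀-reflect-∞ B p of λ ())

    copy-image-not-top : (a : Adj G u v) → ¬ IsTop (h₀ (copy a))
    copy-image-not-top a t = tops-distinct (trans (below-image ⊤₁) (sym (below-image ⊤₂)))
      where
      below-image : IsTop T → h₀ T ≡ h₀ (copy a)
      below-image t' = max-up (inj₁ t) (h₀-mono (copy≺top t' a ◅ ε))

    copy-image : (a : Adj G u v) → Σ[ b ∈ Adj H (g u) (g v) ] h₀ (copy a) ≡ copy b
    copy-image a with shape (h₀ (copy a))
    ... | below-∞ s le = ⊥-elim (copy-not-below-∞ s a (h₀-reflect-below-∞ s le))
    ... | top t = ⊥-elim (copy-image-not-top a t)
    ... | edge c p
      with va≤copy c (subst₂ _≤_ h₀-va p (h₀-mono (tail≺copy a ◅ ε)))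
         | vb≤copy c (subst₂ _≤_ h₀-vb p (h₀-mono (head≺copy a ◅ ε)))
    ...   | refl | refl = c , p

    copy-preimage : {z : PosEl G} {w₁ w₂ : V H} {b : Adj H w₁ w₂} → h₀ z ≡ copy b →
      Σ[ u ∈ V G ] Σ[ v ∈ V G ] Σ[ c ∈ Adj G u v ] z ≡ copy c
    copy-preimage {z} {b = b} p with shape z
    ... | below-∞ s le = ⊥-elim (copy-not-below-∞ s b (subst (_≤ ∞ s) p (h₀-below-∞ s le)))
    ... | top t        = ⊥-elim (copy-not-top b (subst IsTop p (h₀-top t)))
    ... | edge c q     = _ , _ , c , q

    g-back : ∀ u w → Adj H (g u) w → Σ[ v ∈ V G ] Adj G u v × g v ≡ w
    g-back u w b with h₀-back (subst (_≤ copy b) (sym h₀-vtx) (v≺va (g u) ◅ tail≺copy b ◅ ε))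
    ... | z , u≤z , hz with copy-preimage hz
    ...   | _ , _ , c , refl with copy-image c | vtx≤copy c u≤z
    ...     | b' , p | inj₁ refl = _ , c , proj₂ (copy-injective b' b (trans (sym p) hz))
    ...     | b' , p | inj₂ refl =
      ⊥-elim (Adj-irrefl {H} b' (proj₁ (copy-injective b' b (trans (sym p) hz))))

    loc-surj-hom : Σ (V G → V H) λ g → Surjective g × IsLocSurjHom G H g
    loc-surj-hom = g , g-surj , (λ u v a → proj₁ (copy-image a)) , g-back

fix-infinities : {G H : Graph} → V H → SurjectivePMorphism (Pos⊥ G) (Pos⊥ H) →
  Σ[ (h , _) ∈ SurjectivePMorphism (Pos⊥ G) (Pos⊥ H) ] (∀ s → h (lift (∞ s)) ≡ lift (∞ s))
fix-infinities w₀ φ@(h , h-surj , h-pmor) with ToLocSurjHom.orientation w₀ h h-surj h-pmor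
... | inj₁ (p , q) = φ , λ { A → p ; B → q }
... | inj₂ (p , q) =
  ∘-surjective-pmorphism {R = Pos⊥ _} swap-pmorphism φ ,
  λ { A → cong (map⊥ swap) p ; B → cong (map⊥ swap) q }

corollary2 : (G H : Graph) → V H →
    (Σ (V G → V H) λ g → Surjective g × IsLocSurjHom G H g) ⇔
    (Σ (PosEl⊥ G → PosEl⊥ H) λ h → Surjective h × IsPMorphism (Pos⊥ G) (Pos⊥ H) h)
corollary2 G H w₀ = mk⇔
  (λ (g , g-surj , g-lsh) → FromLocSurjHom.pmorphism g g-surj g-lsh)
  (λ φ → let ((h , h-surj , h-pmor) , h-∞) = fix-infinities w₀ φ
         in ToLocSurjHom.WithFixedInfinities.loc-surj-hom w₀ h h-surj h-pmor h-∞)
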